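{- Let $\mathbf{C}$ be the natural deduction system described in the context. In a deduction in $\mathbf{C}$ in normal form, if any major premises of elimination rules lie on a branch, then they precede (on that branch) every major assumption discharged by an introduction rule that lies on the branch.
   Context: Formulas are built from atomic formulas (formulas containing no connective) by the connectives $\neg$ (unary), $\supset$, $\land$, $\lor$. Deductions in $\mathbf{C}$ are trees of formula occurrences whose leaves are assumptions; each assumption belongs to an assumption class marked by a number, and a rule discharging class $i$ (written $[X]^i$) discharges all assumptions of that class above the indicated premise. A single assumption $A$ is a deduction of $A$ from $A$. Rules ($C$ arbitrary): $\land I$: from $A$, $B$, and a deduction of $C$ from $[A\land B]$, infer $C$. $\land E$: from $A\land B$ and a deduction of $C$ from $[A]$, $[B]$, infer $C$. $\lor I$: from $A$ (or from $B$) and a deduction of $C$ from $[A\lor B]$, infer $C$. $\lor E$: from $A\lor B$, a deduction of $C$ from $[A]$, and a deduction of $C$ from $[B]$, infer $C$. $\supset I$: from $B$ and a deduction of $C$ from $[A\supset B]$, infer $C$. $TR$ (an introduction rule for $\supset$): from a deduction of $C$ from $[A]$ and a deduction of $C$ from $[A\supset B]$, infer $C$. $\supset E$: from $A\supset B$, $A$, and a deduction of $C$ from $[B]$, infer $C$. $\neg I$: from a deduction of $C$ from $[A]$ and a deduction of $C$ from $[\neg A]$, infer $C$. $\neg E$: from $\neg A$ and $A$, infer $C$. Introduction rules: $\land I,\lor I,\supset I,TR,\neg I$; elimination rules: $\land E,\lor E,\supset E,\neg E$. In elimination rules $A\land B, A\lor B, A\supset B,\neg A$ are the major premises and $A$ in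 $\supset E$ and $\neg E$ is the minor premise; premises in the place of $C$ (in any rule) are arbitrary premises; $A$, $B$ in $\land I$, $A$ or $B$ in $\lor I$, and $B$ in $\supset I$ are specific premises; the discharged $A\land B$, $A\lor B$, $A\supset B$ (in $\supset I$ and $TR$), $\neg A$ (in $\neg I$) are the major assumptions discharged by the introduction rule. Convention: there is no vacuous discharge above arbitrary premises. A maximal formula is an occurrence of a formula with main connective $\ast$ that is both the major premise of an application of $\ast E$ and the major assumption discharged by an application of $\ast I$ (or of $TR$ when $\ast$ is $\supset$). A segment is a sequence $C_1,\dots,C_n$ of occurrences of the same formula such that for all $i<n$, $C_i$ is an arbitrary premise of a rule application whose conclusion is $C_{i+1}$, $C_n$ is not an arbitrary premise of any rule application, and either $n>1$, or $n\ge 1$ and $C_1$ is the conclusion of an application of $\neg E$. A maximal segment is a segment whose last formula is the major premise of an elimination rule. A deduction is in normal form if it contains neither maximal formulas nor maximal segments. A branch in a deduction is a sequence of formula occurrences $\sigma_1,\dots,\sigma_n$ such that $\sigma_1$ is an assumption of the deduction that is neither discharged by an elimination rule nor the major assumption discharged by an introduction rule other than $\neg I$ or $TR$; $\sigma_n$ is either the conclusion of the deduction or the minor premise of $\supset E$ or $\neg E$; and for each $i<n$: (i) if $\sigma_i$ is the major premise of an elimination rule other than $\neg E$, $\sigma_{i+1}$ is an assumption discharged by it, and if it is the major premise of $\neg E$, $\sigma_{i+1}$ is the conclusion of that rule; (ii) if $\sigma_i$ is the specific premise of an introduction rule, $\sigma_{i+1}$ is a major assumption discharged by it; (iii) if $\sigma_i$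 is an arbitrary premise of a rule, $\sigma_{i+1}$ is the conclusion of that rule. -}

module Defs where

open import Data.Nat using (ℕ; _<_)
open import Data.Fin as F using (Fin; toℕ; inject₁; fromℕ)
open import Data.List using (List; []; _∷_; _++_; [_]; length; lookup)
open import Data.List.Relation.Unary.All using (All)
open import Data.List.Membership.Propositional using (_∈_)
open import Data.Product using (Σ; ∃; _×_; _,_)
open import Data.Sum using (_⊎_)
open import Data.Bool using (Bool; true; false)
open import Data.Unit using (⊤)
open import Relation.Binary.PropositionalEquality using (_≡_; _≢_)
open import Relation.Nullary using (¬_)

infixr 6 _⊃_
infixr 7 _∨_
infixr 8 _∧_

data Form : Set where
  atom : ℕ → Form
  neg  : Form → Form
  _⊃_ _∧_ _∨_ : Form → Form → Form

-- The natural numbers are the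
-- assumption classes discharged by the rule.
--   ∧I A B C i   : premises A, B, C ; discharges [A ∧ B]^i above C (3rd)
--   ∧E A B C i j : premises A ∧ B, C ; discharges [A]^i, [B]^j above C
--   ∨I₁ A B C i  : premises A, C ; discharges [A ∨ B]^i above C
--   ∨I₂ A B C i  : premises B, C ; discharges [A ∨ B]^i above C
--   ∨E A B C i j : premises A ∨ B, C, C ; [A]^i above 2nd, [B]^j above 3rd
--   ⊃I A B C i   : premises B, C ; discharges [A ⊃ B]^i above C
--   TR A B C i j : premises C, C ; [A]^i above 1st, [A ⊃ B]^j above 2nd
--   ⊃E A B C i   : premises A ⊃ B, A, C ; discharges [B]^i above C
--   ¬I A C i j   : premises C, C ; [A]^i above 1st, [¬A]^j above 2nd
--   ¬E A C       : premises ¬A, A ; conclusion C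

data Rule : List Form → Form → Set where
  ∧I  : (A B C : Form) (i : ℕ)   → Rule (A ∷ B ∷ C ∷ []) C
  ∧E  : (A B C : Form) (i j : ℕ) → Rule (A ∧ B ∷ C ∷ []) C
  ∨I₁ : (A B C : Form) (i : ℕ)   → Rule (A ∷ C ∷ []) C
  ∨I₂ : (A B C : Form) (i : ℕ)   → Rule (B ∷ C ∷ []) C
  ∨E  : (A B C : Form) (i j : ℕ) → Rule (A ∨ B ∷ C ∷ C ∷ []) C
  ⊃I  : (A B C : Form) (i : ℕ)   → Rule (B ∷ C ∷ []) C
  TR  : (A B C : Form) (i j : ℕ) → Rule (C ∷ C ∷ []) C
  ⊃E  : (A B C : Form) (i : ℕ)   → Rule (A ⊃ B ∷ A ∷ C ∷ []) C
  ¬I  : (A C : Form) (i j : ℕ)   → Rule (C ∷ C ∷ []) C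
  ¬E  : (A C : Form)             → Rule (neg A ∷ A ∷ []) C

data Kind : Set where
  intro elim : Kind

kind : ∀ {Ps C} → Rule Ps C → Kind
kind (∧I _ _ _ _)   = intro
kind (∧E _ _ _ _ _) = elim
kind (∨I₁ _ _ _ _)  = intro
kind (∨I₂ _ _ _ _)  = intro
kind (∨E _ _ _ _ _) = elim
kind (⊃I _ _ _ _)   = intro
kind (TR _ _ _ _ _) = intro
kind (⊃E _ _ _ _)   = elim
kind (¬I _ _ _ _)   = intro
kind (¬E _ _)       = elim

data Role : Set where
  major minor specific arbitrary : Role

role : ∀ {Ps C} → Rule Ps C → Fin (length Ps) → Role
role (∧I _ _ _ _)   F.zero             = specific
role (∧I _ _ _ _)   (F.suc F.zero)     = specific
role (∧I _ _ _ _)   (F.suc (F.suc _))  = arbitrary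
role (∧E _ _ _ _ _) F.zero             = major
role (∧E _ _ _ _ _) (F.suc _)          = arbitrary
role (∨I₁ _ _ _ _)  F.zero             = specific
role (∨I₁ _ _ _ _)  (F.suc _)          = arbitrary
role (∨I₂ _ _ _ _)  F.zero             = specific
role (∨I₂ _ _ _ _)  (F.suc _)          = arbitrary
role (∨E _ _ _ _ _) F.zero             = major
role (∨E _ _ _ _ _) (F.suc _)          = arbitrary
role (⊃I _ _ _ _)   F.zero             = specific
role (⊃I _ _ _ _)   (F.suc _)          = arbitrary
role (TR _ _ _ _ _) _                  = arbitrary
role (⊃E _ _ _ _)   F.zero             = major
role (⊃E _ _ _ _)   (F.suc F.zero)     = minor
role (⊃E _ _ _ _)   (F.suc (F.suc _))  = arbitrary
role (¬I _ _ _ _)   _                  = arbitrary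
role (¬E _ _)       F.zero             = major
role (¬E _ _)       (F.suc _)          = minor

record Discharge : Set where
  constructor disc
  field
    cls   : ℕ
    frm   : Form
    isMaj : Bool
open Discharge public

disch : ∀ {Ps C} → Rule Ps C → Fin (length Ps) → List Discharge
disch (∧I A B C i)   (F.suc (F.suc F.zero)) = [ disc i (A ∧ B) true ]
disch (∧E A B C i j) (F.suc F.zero)         = disc i A false ∷ disc j B false ∷ []
disch (∨I₁ A B C i)  (F.suc F.zero)         = [ disc i (A ∨ B) true ]
disch (∨I₂ A B C i)  (F.suc F.zero)         = [ disc i (A ∨ B) true ]
disch (∨E A B C i j) (F.suc F.zero)         = [ disc i A false ]
disch (∨E A B C i j) (F.suc (F.suc F.zero)) = [ disc j B false ]
disch (⊃I A B C i)   (F.suc F.zero)         = [ disc i (A ⊃ B) true ]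
disch (TR A B C i j) F.zero                 = [ disc i A false ]
disch (TR A B C i j) (F.suc F.zero)         = [ disc j (A ⊃ B) true ]
disch (⊃E A B C i)   (F.suc (F.suc F.zero)) = [ disc i B false ]
disch (¬I A C i j)   F.zero                 = [ disc i A false ]
disch (¬I A C i j)   (F.suc F.zero)         = [ disc j (neg A) true ]
disch _ _ = []

data IsNegE : ∀ {Ps C} → Rule Ps C → Set where
  isNegE : ∀ {A C} → IsNegE (¬E A C)

data IsNegIOrTR : ∀ {Ps C} → Rule Ps C → Set where
  isNegI : ∀ {A C i j} → IsNegIOrTR (¬I A C i j)
  isTR   : ∀ {A B C i j} → IsNegIOrTR (TR A B C i j)

data Deriv : Form → Set where
  ass  : (c : ℕ) (A : Form) → Deriv A
  node : ∀ {Ps C} → Rule Ps C → ((k : Fin (length Ps)) → Deriv (lookup Ps k)) → Deriv C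

-- formula occurrences are addressed by paths from the root
Path : Set
Path = List ℕ

data SubAt : ∀ {C} → Deriv C → Path → ∀ {C'} → Deriv C' → Set where
  here  : ∀ {C} {d : Deriv C} → SubAt d [] d
  there : ∀ {Ps C C'} {r : Rule Ps C} {ch : (k : Fin (length Ps)) → Deriv (lookup Ps k)}
            {p : Path} {d : Deriv C'} (k : Fin (length Ps)) →
          SubAt (ch k) p d → SubAt (node r ch) (toℕ k ∷ p) d

FormAt : ∀ {C} → Deriv C → Path → Form → Set
FormAt D p A = Σ (Deriv A) λ d → SubAt D p d

LeafAt : ∀ {C} → Deriv C → Path → Set
LeafAt D p = Σ ℕ λ c → Σ Form λ A → SubAt D p (ass c A)

data Free : ∀ {C} → Deriv C → Path → ℕ → Form → Set where
  leaf : ∀ {c A} → Free (ass c A) [] c A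
  step : ∀ {Ps C} {r : Rule Ps C} {ch : (k : Fin (length Ps)) → Deriv (lookup Ps k)}
           {s c A} (k : Fin (length Ps)) →
         Free (ch k) s c A → All (λ dd → cls dd ≢ c) (disch r k) →
         Free (node r ch) (toℕ k ∷ s) c A

-- correctness of a discharge of dd above a premise whose subdeduction is d:
-- discharged assumptions have the right formula, and the discharge is not
-- vacuous (all discharges in C are above arbitrary premises).
DischOK : ∀ {C} → Deriv C → Discharge → Set
DischOK d dd = (∀ s A → Free d s (cls dd) A → A ≡ frm dd)
             × (Σ Path λ s → Σ Form λ A → Free d s (cls dd) A)

data Valid : ∀ {C} → Deriv C → Set where
  ass  : ∀ {c A} → Valid (ass c A)
  node : ∀ {Ps C} {r : Rule Ps C} {ch : (k : Fin (length Ps)) → Deriv (lookup Ps k)} →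
         (∀ k → Valid (ch k)) → (∀ k → All (DischOK (ch k)) (disch r k)) →
         Valid (node r ch)

data PremWith {C} (D : Deriv C) (P : ∀ {Ps C'} → Rule Ps C' → Fin (length Ps) → Set)
              (p q : Path) : Set where
  pw : ∀ {Ps C'} {r : Rule Ps C'} {ch : (k : Fin (length Ps)) → Deriv (lookup Ps k)} →
       SubAt D q (node r ch) → (k : Fin (length Ps)) → p ≡ q ++ [ toℕ k ] → P r k →
       PremWith D P p q

data DischBy {C} (D : Deriv C) (P : ∀ {Ps C'} → Rule Ps C' → Discharge → Set)
             (b q : Path) : Set where
  db : ∀ {Ps C'} {r : Rule Ps C'} {ch : (k : Fin (length Ps)) → Deriv (lookup Ps k)} →
       SubAt D q (node r ch) → (k : Fin (length Ps)) → (s : Path) →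
       b ≡ q ++ (toℕ k ∷ s) → (dd : Discharge) → dd ∈ disch r k →
       (A : Form) → Free (ch k) s (cls dd) A → P r dd →
       DischBy D P b q

MajPremElim : ∀ {C} → Deriv C → Path → Set
MajPremElim D p = Σ Path λ q → PremWith D (λ r k → kind r ≡ elim × role r k ≡ major) p q

MajAssIntro : ∀ {C} → Deriv C → Path → Set
MajAssIntro D p = Σ Path λ q → DischBy D (λ r dd → kind r ≡ intro × isMaj dd ≡ true) p q

ArbPrem : ∀ {C} → Deriv C → Path → Path → Set
ArbPrem D p q = PremWith D (λ r k → role r k ≡ arbitrary) p q

ConclOfNegE : ∀ {C} → Deriv C → Path → Set
ConclOfNegE D p = Σ (List Form) λ Ps → Σ Form λ C' → Σ (Rule Ps C') λ r →
  Σ ((k : Fin (length Ps)) → Deriv (lookup Ps k)) λ ch → SubAt D p (node r ch) × IsNegE r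

MaxFormula : ∀ {C} → Deriv C → Path → Set
MaxFormula D p = MajPremElim D p × MajAssIntro D p

-- a segment C_1..C_{n+1} (indices 0..n)
Segment : ∀ {C} → Deriv C → (n : ℕ) → (Fin (ℕ.suc n) → Path) → Set
Segment D n c =
    (Σ Form λ A → ∀ i → FormAt D (c i) A)
  × (∀ (i : Fin n) → ArbPrem D (c (inject₁ i)) (c (F.suc i)))
  × (¬ (Σ Path λ q → ArbPrem D (c (fromℕ n)) q))
  × (0 < n ⊎ ConclOfNegE D (c F.zero))

MaxSegment : ∀ {C} → Deriv C → (n : ℕ) → (Fin (ℕ.suc n) → Path) → Set
MaxSegment D n c = Segment D n c × MajPremElim D (c (fromℕ n))

Normal : ∀ {C} → Deriv C → Set
Normal D = (∀ p → ¬ MaxFormula D p)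
         × (∀ n (c : Fin (ℕ.suc n) → Path) → ¬ MaxSegment D n c)

Step : ∀ {C} → Deriv C → Path → Path → Set
Step D a b = Σ Path λ q →
    (PremWith D (λ r k → kind r ≡ elim × role r k ≡ major × IsNegE r) a q × b ≡ q)
  ⊎ (PremWith D (λ r k → kind r ≡ elim × role r k ≡ major × ¬ IsNegE r) a q
       × DischBy D (λ r dd → ⊤) b q)
  ⊎ (PremWith D (λ r k → kind r ≡ intro × role r k ≡ specific) a q
       × DischBy D (λ r dd → isMaj dd ≡ true) b q)
  ⊎ (ArbPrem D a q × b ≡ q)

-- a branch σ_1..σ_{n+1} (indices 0..n)
Branch : ∀ {C} → Deriv C → (n : ℕ) → (Fin (ℕ.suc n) → Path) → Set
Branch D n σ =
    LeafAt D (σ F.zero)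
  × ¬ (Σ Path λ q → DischBy D (λ r dd → kind r ≡ elim) (σ F.zero) q)
  × ¬ (Σ Path λ q → DischBy D (λ r dd → kind r ≡ intro × isMaj dd ≡ true × ¬ IsNegIOrTR r)
                              (σ F.zero) q)
  × (σ (fromℕ n) ≡ [] ⊎ (Σ Path λ q → PremWith D (λ r k → role r k ≡ minor) (σ (fromℕ n)) q))
  × (∀ (i : Fin n) → Step D (σ (inject₁ i)) (σ (F.suc i)))

{-# OPTIONS --safe #-}

-- Follow a branch from an occurrence σⱼ that is a major assumption discharged by an
-- introduction.  Each step either goes from an arbitrary premise to the conclusion
-- (same formula), from a specific premise of an introduction to the major assumption
-- it discharges (a fresh start), or leaves a major premise of an elimination.  The
-- occurrences since the last fresh start form a run of one formula that begins with a
-- major assumption of an introduction and is linked by arbitrary premises.  If the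
-- run ended in a major premise of an elimination, it would be a maximal formula (run
-- of length one) or a maximal segment.  So in a normal deduction the walk never meets
-- such a premise at or after σⱼ.

module Submission where

open import Defs
open import Data.Nat using (ℕ; suc; zero; s≤s; z≤n)
open import Data.Nat.Properties using (≮⇒≥)
open import Data.Fin using (Fin; _<_; _≤_; fromℕ; inject₁)
import Data.Fin as F
open import Data.Fin.Properties using (toℕ-injective; _<?_)
open import Data.Fin.Induction using (<-weakInduction-startingFrom)
open import Data.Vec.Functional using (Vector; tail)
open import Data.List using (_++_; lookup; length)
open import Data.List.Properties using (∷ʳ-injective; ∷-injective)
open import Data.List.Membership.Propositional using (_∈_)
import Data.List.Relation.Unary.Any as Any
open import Data.Product using (Σ; _×_; _,_; proj₁; proj₂)
open import Data.Sum using (inj₁; inj₂)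
open import Data.Empty using (⊥-elim)
open import Data.Bool using (true)
open import Relation.Nullary using (¬_; yes; no)
open import Relation.Binary.PropositionalEquality

module _ {A : Set} where

  _∷ʳ_ : ∀ {n} → Vector A n → A → Vector A (suc n)
  _∷ʳ_ {zero}  xs x _         = x
  _∷ʳ_ {suc n} xs x F.zero    = xs F.zero
  _∷ʳ_ {suc n} xs x (F.suc i) = (tail xs ∷ʳ x) i

  Linked : ∀ {n} → (A → A → Set) → Vector A (suc n) → Set
  Linked {n} R xs = (i : Fin n) → R (xs (inject₁ i)) (xs (F.suc i))

  ∷ʳ-last : ∀ {n} (xs : Vector A n) x → (xs ∷ʳ x) (fromℕ n) ≡ x
  ∷ʳ-last {zero}  xs x = refl
  ∷ʳ-last {suc n} xs x = ∷ʳ-last (tail xs) x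

  ∷ʳ-all : ∀ {n} (P : A → Set) {xs : Vector A n} {x} →
           (∀ i → P (xs i)) → P x → ∀ i → P ((xs ∷ʳ x) i)
  ∷ʳ-all {zero}  P Pxs Px _         = Px
  ∷ʳ-all {suc n} P Pxs Px F.zero    = Pxs F.zero
  ∷ʳ-all {suc n} P Pxs Px (F.suc i) = ∷ʳ-all P (λ i → Pxs (F.suc i)) Px i

  ∷ʳ-linked : ∀ {n} (R : A → A → Set) {xs : Vector A (suc n)} {x} →
              Linked R xs → R (xs (fromℕ n)) x → Linked R (xs ∷ʳ x)
  ∷ʳ-linked {zero}  R lxs r F.zero    = r
  ∷ʳ-linked {suc n} R lxs r F.zero    = lxs F.zero
  ∷ʳ-linked {suc n} R lxs r (F.suc i) = ∷ʳ-linked R (λ i → lxs (F.suc i)) r i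

SubAt-functional : ∀ {C A B} {D : Deriv C} {p} {d : Deriv A} {e : Deriv B} →
                   SubAt D p d → SubAt D p e → _≡_ {A = Σ Form Deriv} (A , d) (B , e)
SubAt-functional s t = go s t refl
  where
  go : ∀ {C A B} {D : Deriv C} {p p′} {d : Deriv A} {e : Deriv B} →
       SubAt D p d → SubAt D p′ e → p ≡ p′ → _≡_ {A = Σ Form Deriv} (A , d) (B , e)
  go here        here         _  = refl
  go here        (there _ _)  ()
  go (there _ _) here         ()
  go (there k s) (there k′ t) eq with ∷-injective eq
  ... | k≡k′ , p≡p′ with refl ← toℕ-injective k≡k′ = go s t p≡p′

FormAt-unique : ∀ {C A B} {D : Deriv C} {p} → FormAt D p A → FormAt D p B → A ≡ B
FormAt-unique (_ , s) (_ , t) = cong proj₁ (SubAt-functional s t)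

SubAt-++ : ∀ {C E A} {D : Deriv C} {e : Deriv E} {d : Deriv A} {q s} →
           SubAt D q e → SubAt e s d → SubAt D (q ++ s) d
SubAt-++ here        t = t
SubAt-++ (there k s) t = there k (SubAt-++ s t)

Free⇒SubAt : ∀ {C} {d : Deriv C} {s c A} → Free d s c A → SubAt d s (ass c A)
Free⇒SubAt leaf         = here
Free⇒SubAt (step k f _) = there k (Free⇒SubAt f)

arbitrary-premise≡conclusion : ∀ {Ps C} (r : Rule Ps C) k → role r k ≡ arbitrary → lookup Ps k ≡ C
arbitrary-premise≡conclusion (∧I _ _ _ _)   F.zero                     ()
arbitrary-premise≡conclusion (∧I _ _ _ _)   (F.suc F.zero)             ()
arbitrary-premise≡conclusion (∧I _ _ _ _)   (F.suc (F.suc F.zero))     _ = refl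
arbitrary-premise≡conclusion (∧E _ _ _ _ _) F.zero                     ()
arbitrary-premise≡conclusion (∧E _ _ _ _ _) (F.suc F.zero)             _ = refl
arbitrary-premise≡conclusion (∨I₁ _ _ _ _)  F.zero                     ()
arbitrary-premise≡conclusion (∨I₁ _ _ _ _)  (F.suc F.zero)             _ = refl
arbitrary-premise≡conclusion (∨I₂ _ _ _ _)  F.zero                     ()
arbitrary-premise≡conclusion (∨I₂ _ _ _ _)  (F.suc F.zero)             _ = refl
arbitrary-premise≡conclusion (∨E _ _ _ _ _) F.zero                     ()
arbitrary-premise≡conclusion (∨E _ _ _ _ _) (F.suc F.zero)             _ = refl
arbitrary-premise≡conclusion (∨E _ _ _ _ _) (F.suc (F.suc F.zero))     _ = refl
arbitrary-premise≡conclusion (⊃I _ _ _ _)   F.zero                     ()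
arbitrary-premise≡conclusion (⊃I _ _ _ _)   (F.suc F.zero)             _ = refl
arbitrary-premise≡conclusion (TR _ _ _ _ _) F.zero                     _ = refl
arbitrary-premise≡conclusion (TR _ _ _ _ _) (F.suc F.zero)             _ = refl
arbitrary-premise≡conclusion (⊃E _ _ _ _)   F.zero                     ()
arbitrary-premise≡conclusion (⊃E _ _ _ _)   (F.suc F.zero)             ()
arbitrary-premise≡conclusion (⊃E _ _ _ _)   (F.suc (F.suc F.zero))     _ = refl
arbitrary-premise≡conclusion (¬I _ _ _ _)   F.zero                     _ = refl
arbitrary-premise≡conclusion (¬I _ _ _ _)   (F.suc F.zero)             _ = refl
arbitrary-premise≡conclusion (¬E _ _)       F.zero                     ()
arbitrary-premise≡conclusion (¬E _ _)       (F.suc F.zero)             ()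

major-discharge⇒intro : ∀ {Ps C} (r : Rule Ps C) k {dd} → dd ∈ disch r k → isMaj dd ≡ true →
                        kind r ≡ intro
major-discharge⇒intro (∧I _ _ _ _)   _ _ _ = refl
major-discharge⇒intro (∨I₁ _ _ _ _)  _ _ _ = refl
major-discharge⇒intro (∨I₂ _ _ _ _)  _ _ _ = refl
major-discharge⇒intro (⊃I _ _ _ _)   _ _ _ = refl
major-discharge⇒intro (TR _ _ _ _ _) _ _ _ = refl
major-discharge⇒intro (¬I _ _ _ _)   _ _ _ = refl
major-discharge⇒intro (∧E _ _ _ _ _) (F.suc F.zero)         (Any.here refl)             ()
major-discharge⇒intro (∧E _ _ _ _ _) (F.suc F.zero)         (Any.there (Any.here refl)) ()
major-discharge⇒intro (∨E _ _ _ _ _) (F.suc F.zero)         (Any.here refl)             ()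
major-discharge⇒intro (∨E _ _ _ _ _) (F.suc (F.suc F.zero)) (Any.here refl)             ()
major-discharge⇒intro (⊃E _ _ _ _)   (F.suc (F.suc F.zero)) (Any.here refl)             ()

module _ {C} {D : Deriv C} where

  PremWith-map : ∀ {P Q : ∀ {Ps C′} → Rule Ps C′ → Fin (length Ps) → Set} {p q} →
                 (∀ {Ps C′} (r : Rule Ps C′) k → P r k → Q r k) →
                 PremWith D P p q → PremWith D Q p q
  PremWith-map f (pw s k e Pk) = pw s k e (f _ k Pk)

  PremWith-∩ : ∀ {P Q : ∀ {Ps C′} → Rule Ps C′ → Fin (length Ps) → Set} {p q q′} →
               PremWith D P p q → PremWith D Q p q′ → PremWith D (λ r k → P r k × Q r k) p q
  PremWith-∩ (pw s k e Pk) (pw s′ k′ e′ Qk′) with ∷ʳ-injective _ _ (trans (sym e) e′)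
  ... | refl , k≡k′ with refl ← SubAt-functional s s′ with refl ← toℕ-injective k≡k′ =
    pw s k e (Pk , Qk′)

  MajPremElim⇒¬ArbPrem : ∀ {p q} → MajPremElim D p → ¬ ArbPrem D p q
  MajPremElim⇒¬ArbPrem (_ , maj) arb with pw _ _ _ ((_ , maj-role) , arb-role) ← PremWith-∩ maj arb
    with () ← trans (sym maj-role) arb-role

  ArbPrem-FormAt : ∀ {p q A} → ArbPrem D p q → FormAt D p A → FormAt D q A
  ArbPrem-FormAt {A = A} (pw {C' = C′} {r = r} {ch} s k refl arb) p∶A =
    subst (FormAt D _) C′≡A (node r ch , s)
    where
    C′≡A : C′ ≡ A
    C′≡A = trans (sym (arbitrary-premise≡conclusion r k arb))
                 (FormAt-unique (ch k , SubAt-++ s (there k here)) p∶A)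

  DischBy-FormAt : ∀ {P : ∀ {Ps C′} → Rule Ps C′ → Discharge → Set} {b q} →
                   DischBy D P b q → Σ Form (FormAt D b)
  DischBy-FormAt (db s k _ refl _ _ A f _) = A , ass _ A , SubAt-++ s (there k (Free⇒SubAt f))

  major-discharge⇒MajAssIntro : ∀ {b q} → DischBy D (λ r dd → isMaj dd ≡ true) b q →
                                MajAssIntro D b
  major-discharge⇒MajAssIntro (db {r = r} s k sp e dd dd∈ A f maj) =
    _ , db s k sp e dd dd∈ A f (major-discharge⇒intro r k dd∈ maj , maj)

module _ {C} (D : Deriv C) where

  -- The part of a would-be segment from its first occurrence, a major assumption
  -- discharged by an introduction, down to the occurrence x.
  record IntroRun (x : Path) : Set where
    constructor introRun
    field
      len         : ℕ
      occ         : Vector Path (suc len)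
      formula     : Form
      occ∶formula : ∀ i → FormAt D (occ i) formula
      linked      : Linked (ArbPrem D) occ
      head        : MajAssIntro D (occ F.zero)
      last        : occ (fromℕ len) ≡ x

  IntroRun-start : ∀ {b} → MajAssIntro D b → IntroRun b
  IntroRun-start b∶maj@(_ , b∶disch) with A , b∶A ← DischBy-FormAt b∶disch =
    introRun 0 (λ _ → _) A (λ _ → b∶A) (λ ()) b∶maj refl

  IntroRun-snoc : ∀ {x y} → IntroRun x → ArbPrem D x y → IntroRun y
  IntroRun-snoc {y = y} (introRun len occ A occ∶A linked head refl) arb =
    introRun (suc len) (occ ∷ʳ y) A
      (∷ʳ-all (λ p → FormAt D p A) occ∶A (ArbPrem-FormAt arb (occ∶A (fromℕ len))))
      (∷ʳ-linked (ArbPrem D) linked arb) head (∷ʳ-last occ y)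

  module _ (normal : Normal D) where

    IntroRun⇒¬MajPremElim : ∀ {x} → IntroRun x → ¬ MajPremElim D x
    IntroRun⇒¬MajPremElim (introRun zero occ A occ∶A linked head refl) prem =
      proj₁ normal (occ F.zero) (prem , head)
    IntroRun⇒¬MajPremElim (introRun (suc l) occ A occ∶A linked head refl) prem =
      proj₂ normal (suc l) occ (segment , prem)
      where
      segment : Segment D (suc l) occ
      segment = (A , occ∶A) , linked , (λ (_ , arb) → MajPremElim⇒¬ArbPrem prem arb) , inj₁ (s≤s z≤n)

    IntroRun-step : ∀ {x y} → IntroRun x → Step D x y → IntroRun y
    IntroRun-step run (_ , inj₁ (prem , _)) =
      ⊥-elim (IntroRun⇒¬MajPremElim run (_ , PremWith-map (λ _ _ (e , m , _) → e , m) prem))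
    IntroRun-step run (_ , inj₂ (inj₁ (prem , _))) =
      ⊥-elim (IntroRun⇒¬MajPremElim run (_ , PremWith-map (λ _ _ (e , m , _) → e , m) prem))
    IntroRun-step run (_ , inj₂ (inj₂ (inj₁ (_ , disch)))) =
      IntroRun-start (major-discharge⇒MajAssIntro disch)
    IntroRun-step run (_ , inj₂ (inj₂ (inj₂ (arb , refl)))) = IntroRun-snoc run arb

    IntroRun-along : ∀ {n} {σ : Vector Path (suc n)} → Linked (Step D) σ →
                     ∀ {i j} → MajAssIntro D (σ j) → j ≤ i → IntroRun (σ i)
    IntroRun-along {σ = σ} steps j∶maj =
      <-weakInduction-startingFrom (λ t → IntroRun (σ t)) (IntroRun-start j∶maj)
        (λ t run → IntroRun-step run (steps t))

corollary1 : ∀ {C} (D : Deriv C) → Valid D → Normal D →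
    ∀ (n : ℕ) (σ : Fin (suc n) → Path) → Branch D n σ →
    ∀ (i j : Fin (suc n)) → MajPremElim D (σ i) → MajAssIntro D (σ j) → i < j
corollary1 D _ normal n σ (_ , _ , _ , _ , steps) i j i∶elim j∶maj with i <? j
... | yes i<j = i<j
... | no  i≮j = ⊥-elim (IntroRun⇒¬MajPremElim D normal run i∶elim)
  where
  run : IntroRun D (σ i)
  run = IntroRun-along D normal steps j∶maj (≮⇒≥ i≮j)
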